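{- For every integer $d\geqslant 2$, we have $\mathrm{bp}_2(K_{b(d)})\leqslant d$.
   Context: $K_N$ denotes the complete graph on $N$ vertices. A bipartite clique in $K_N$ is a complete bipartite subgraph of $K_N$ with two non-empty parts. A bipartite $2$-covering of $K_N$ is a family of bipartite cliques in $K_N$ such that every edge of $K_N$ belongs to at least one and at most two members of the family. $\mathrm{bp}_2(K_N)$ is the least number of bipartite cliques in a bipartite $2$-covering of $K_N$. Let $(a(n))_{n\geqslant 1}$ be the non-decreasing sequence of integers that lists every integer $m\geqslant 2$, where each $m$ of the form $3\cdot 2^r$ ($r\geqslant 0$ an integer) appears exactly twice and every other $m\geqslant 2$ appears exactly once; thus $a=2,3,3,4,5,6,6,7,8,\dots$. Define $b(2)=4$ and $b(d)=4+a(1)+\cdots+a(d-2)$ for $d\geqslant 3$. -}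

module Defs where

open import Data.Nat using (ℕ; zero; suc; _+_; _*_; _∸_; _^_; _≤_; _≡ᵇ_)
open import Data.Bool using (Bool; true; false; if_then_else_; _∧_; _∨_)
open import Data.List using (List; []; _∷_; length; map; upTo; concatMap; replicate)
open import Data.Bool.ListAction using (any)
open import Data.Nat.ListAction using (sum)
open import Data.Fin using (Fin)
open import Data.Fin.Subset using (Subset; _∈_; Nonempty)
open import Data.Vec using (lookup)
open import Data.Product using (Σ; _×_)
open import Data.Empty using (⊥)
open import Relation.Binary.PropositionalEquality using (_≢_)

record BipClique (N : ℕ) : Set where
  field
    left  : Subset N
    right : Subset N
    left-nonempty  : Nonempty left
    right-nonempty : Nonempty right
    disjoint : ∀ x → x ∈ left → x ∈ right → ⊥
open BipClique public

containsEdge : ∀ {N} → BipClique N → Fin N → Fin N → Bool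
containsEdge B u v =
  (lookup (left B) u ∧ lookup (right B) v) ∨ (lookup (right B) u ∧ lookup (left B) v)

coverCount : ∀ {N} → List (BipClique N) → Fin N → Fin N → ℕ
coverCount []       u v = 0
coverCount (B ∷ F) u v = (if containsEdge B u v then 1 else 0) + coverCount F u v

IsBip2Covering : ∀ {N} → List (BipClique N) → Set
IsBip2Covering {N} F = ∀ (u v : Fin N) → u ≢ v → 1 ≤ coverCount F u v × coverCount F u v ≤ 2

bp₂≤ : ℕ → ℕ → Set
bp₂≤ N d = Σ (List (BipClique N)) λ F → length F ≤ d × IsBip2Covering F

-- is m of the form 3·2^r ?  (any such r satisfies r < m, so searching r < m suffices)
isThreePow2 : ℕ → Bool
isThreePow2 m = any (λ r → m ≡ᵇ 3 * 2 ^ r) (upTo m)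

mult : ℕ → ℕ
mult m = if isThreePow2 m then 2 else 1

-- initial segment of a: all entries with value in {2, …, K+1}, in order
aPrefix : ℕ → List ℕ
aPrefix K = concatMap (λ m → replicate (mult m) m) (map (2 +_) (upTo K))

nth : List ℕ → ℕ → ℕ
nth []       _       = 0
nth (x ∷ xs) zero    = x
nth (x ∷ xs) (suc i) = nth xs i

-- a(n) for n ≥ 1 (aPrefix n has length ≥ n, so the default 0 is never used for n ≥ 1)
a : ℕ → ℕ
a n = nth (aPrefix n) (n ∸ 1)

b : ℕ → ℕ
b d = 4 + sum (map (λ i → a (suc i)) (upTo (d ∸ 2)))

-- Bicliques B₁ … B_d form a bipartite 2-covering of K_N exactly when the words recording each
-- vertex's side in every Bᵣ are pairwise at distance 1 or 2, distance counting the coordinates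
-- where one word has 𝟎 and the other 𝟏.  Such words are found as labels of the edges of a graph
-- G such that edges sharing a vertex are at distance 1 and all other pairs at distance 1 or 2.
-- Giving a vertex v a twin v′ costs a single new coordinate (𝟎 on the edges at v, 𝟏 on those at
-- v′, ⋆ elsewhere), so starting from K_{2ᵏ+1} complete multipartite graphs grow by one vertex per
-- coordinate.  A variant of the twin step, which trades an edge of an auxiliary vertex for the
-- edge between the twins, turns K_{m+1} into K_{2m+1} with m + 1 new coordinates, giving the
-- seeds K_{2ᵏ+1}.  Following the graphs with 2ᵏ + 1 parts of sizes 2 and 3, and switching to
-- 2ᵏ⁺¹ + 1 parts when sizes 4 would be reached (both have the same number of edges), the
-- number of edges gained with the coordinate after dimension d is at least a(d − 1), so in
-- dimension d there are at least b(d) edges, hence b(d) words.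

module Submission where

open import Defs
open import Data.Bool using (Bool; true; false; if_then_else_; _∧_; _∨_; T)
open import Data.Empty using (⊥; ⊥-elim)
open import Data.Fin using (Fin; zero; suc; inject≤)
open import Data.Fin.Properties using (inject≤-injective)
open import Data.Fin.Subset using (Subset; Nonempty)
import Data.Fin.Subset as Subset
open import Data.Fin.Subset.Properties using (nonempty?)
open import Data.List
  using (List; []; _∷_; [_]; length; map; upTo; applyUpTo; concatMap; replicate; _++_; _∷ʳ_)
import Data.List as List
open import Data.List.Properties
  using ( length-++; length-map; length-upTo; length-applyUpTo; length-replicate
        ; concatMap-++; map-++; upTo-∷ʳ; ++-identityʳ; ++-assoc)
open import Data.List.Membership.Propositional using (lose)
open import Data.List.Membership.Propositional.Properties using (∈-lookup; ∈-upTo⁺)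
open import Data.List.Relation.Unary.All as All using (All; []; _∷_)
import Data.List.Relation.Unary.All.Properties as All
open import Data.List.Relation.Unary.AllPairs as AllPairs using (AllPairs; []; _∷_)
import Data.List.Relation.Unary.AllPairs.Properties as AllPairs
open import Data.List.Relation.Unary.Any.Properties using (any⁺)
open import Data.List.Relation.Unary.Unique.Propositional using (Unique)
import Data.List.Relation.Unary.Unique.Propositional.Properties as Unique
open import Data.Nat using (ℕ; zero; suc; _+_; _*_; _∸_; _^_; _≤_; _<_; z≤n; s≤s; _≤?_)
open import Data.Nat.ListAction using (sum)
open import Data.Nat.ListAction.Properties using (sum-++)
open import Data.Nat.Properties
open import Data.Nat.Tactic.RingSolver using (solve-∀)
open import Data.Product using (Σ; ∃; _×_; _,_; proj₁; proj₂; uncurry)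
open import Data.Product.Properties using (≡-dec)
open import Data.Sum using (_⊎_; inj₁; inj₂)
open import Data.Vec using (Vec; []; _∷_; lookup; tabulate; head; tail)
open import Data.Vec.Properties using (lookup∘tabulate; []=⇒lookup; lookup⇒[]=)
open import Function using (_∘_)
open import Level using (0ℓ)
open import Relation.Binary using (Rel; Symmetric; DecidableEquality)
open import Relation.Binary.PropositionalEquality
  using (_≡_; _≢_; refl; sym; trans; cong; cong₂; subst; subst₂; module ≡-Reasoning)
open import Relation.Nullary using (¬_; Dec; yes; no)
open import Relation.Nullary.Decidable using (_×-dec_; _⊎-dec_)

-- A vertex lies on the left side (𝟎), the right side (𝟏) or outside (⋆) of a biclique.
data Letter : Set where
  𝟎 𝟏 ⋆ : Letter

clash : Letter → Letter → ℕ
clash 𝟎 𝟏 = 1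
clash 𝟏 𝟎 = 1
clash _ _ = 0

dist : ∀ {n} → Vec Letter n → Vec Letter n → ℕ
dist []       []       = 0
dist (x ∷ u) (y ∷ w) = clash x y + dist u w

dist-head-tail : ∀ {n} (u w : Vec Letter (suc n)) →
                 clash (head u) (head w) + dist (tail u) (tail w) ≡ dist u w
dist-head-tail (x ∷ u) (y ∷ w) = refl

clash-self : ∀ x → clash x x ≡ 0
clash-self 𝟎 = refl
clash-self 𝟏 = refl
clash-self ⋆ = refl

clash-sym : ∀ x y → clash x y ≡ clash y x
clash-sym 𝟎 𝟎 = refl
clash-sym 𝟎 𝟏 = refl
clash-sym 𝟎 ⋆ = refl
clash-sym 𝟏 𝟎 = refl
clash-sym 𝟏 𝟏 = refl
clash-sym 𝟏 ⋆ = refl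
clash-sym ⋆ 𝟎 = refl
clash-sym ⋆ 𝟏 = refl
clash-sym ⋆ ⋆ = refl

dist-self : ∀ {n} (u : Vec Letter n) → dist u u ≡ 0
dist-self []      = refl
dist-self (x ∷ u) = cong₂ _+_ (clash-self x) (dist-self u)

dist-sym : ∀ {n} (u w : Vec Letter n) → dist u w ≡ dist w u
dist-sym []      []      = refl
dist-sym (x ∷ u) (y ∷ w) = cong₂ _+_ (clash-sym x y) (dist-sym u w)

OneOrTwo : ℕ → Set
OneOrTwo n = 1 ≤ n × n ≤ 2

WordCode : ℕ → ℕ → Set
WordCode N d = Σ (Fin N → Vec Letter d) λ w → ∀ u v → u ≢ v → OneOrTwo (dist (w u) (w v))

is𝟎 is𝟏 : Letter → Bool
is𝟎 𝟎 = true
is𝟎 _ = false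
is𝟏 𝟏 = true
is𝟏 _ = false

edge-test≡clash : ∀ x y → (if (is𝟎 x ∧ is𝟏 y) ∨ (is𝟏 x ∧ is𝟎 y) then 1 else 0) ≡ clash x y
edge-test≡clash 𝟎 𝟎 = refl
edge-test≡clash 𝟎 𝟏 = refl
edge-test≡clash 𝟎 ⋆ = refl
edge-test≡clash 𝟏 𝟎 = refl
edge-test≡clash 𝟏 𝟏 = refl
edge-test≡clash 𝟏 ⋆ = refl
edge-test≡clash ⋆ 𝟎 = refl
edge-test≡clash ⋆ 𝟏 = refl
edge-test≡clash ⋆ ⋆ = refl

coverCount-++ : ∀ {N} (F F′ : List (BipClique N)) u v →
                coverCount (F ++ F′) u v ≡ coverCount F u v + coverCount F′ u v
coverCount-++ []      F′ u v = refl
coverCount-++ (B ∷ F) F′ u v rewrite coverCount-++ F F′ u v =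
  sym (+-assoc (if containsEdge B u v then 1 else 0) (coverCount F u v) (coverCount F′ u v))

module Coordinate {N : ℕ} (g : Fin N → Letter) where

  zeros ones : Subset N
  zeros = tabulate (is𝟎 ∘ g)
  ones  = tabulate (is𝟏 ∘ g)

  ∈zeros : ∀ x → g x ≡ 𝟎 → x Subset.∈ zeros
  ∈zeros x gx = lookup⇒[]= x zeros (trans (lookup∘tabulate (is𝟎 ∘ g) x) (cong is𝟎 gx))

  ∈ones : ∀ x → g x ≡ 𝟏 → x Subset.∈ ones
  ∈ones x gx = lookup⇒[]= x ones (trans (lookup∘tabulate (is𝟏 ∘ g) x) (cong is𝟏 gx))

  zeros-ones-disjoint : ∀ x → x Subset.∈ zeros → x Subset.∈ ones → ⊥
  zeros-ones-disjoint x x∈zeros x∈ones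
    with g x | trans (sym (lookup∘tabulate (is𝟎 ∘ g) x)) ([]=⇒lookup x∈zeros)
             | trans (sym (lookup∘tabulate (is𝟏 ∘ g) x)) ([]=⇒lookup x∈ones)
  ... | 𝟎 | _  | ()
  ... | 𝟏 | () | _
  ... | ⋆ | () | _

  bicliques : List (BipClique N)
  bicliques with nonempty? zeros | nonempty? ones
  ... | yes zeros≠∅ | yes ones≠∅ = record
    { left = zeros ; right = ones ; left-nonempty = zeros≠∅ ; right-nonempty = ones≠∅
    ; disjoint = zeros-ones-disjoint } ∷ []
  ... | _ | _ = []

  length-bicliques : length bicliques ≤ 1
  length-bicliques with nonempty? zeros | nonempty? ones
  ... | yes _ | yes _ = ≤-refl
  ... | yes _ | no _  = z≤n
  ... | no _  | _     = z≤n

  clash-side-empty : ∀ u v → ¬ (Nonempty zeros × Nonempty ones) → clash (g u) (g v) ≡ 0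
  clash-side-empty u v empty with g u in gu | g v in gv
  ... | 𝟎 | 𝟎 = refl
  ... | 𝟎 | 𝟏 = ⊥-elim (empty ((u , ∈zeros u gu) , (v , ∈ones v gv)))
  ... | 𝟎 | ⋆ = refl
  ... | 𝟏 | 𝟎 = ⊥-elim (empty ((v , ∈zeros v gv) , (u , ∈ones u gu)))
  ... | 𝟏 | 𝟏 = refl
  ... | 𝟏 | ⋆ = refl
  ... | ⋆ | _ = refl

  coverCount-bicliques : ∀ u v → coverCount bicliques u v ≡ clash (g u) (g v)
  coverCount-bicliques u v with nonempty? zeros | nonempty? ones
  ... | yes _ | yes _ = trans (+-identityʳ _) (trans
        (cong (λ t → if t then 1 else 0)
              (cong₂ _∨_ (cong₂ _∧_ (lookup∘tabulate (is𝟎 ∘ g) u) (lookup∘tabulate (is𝟏 ∘ g) v))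
                         (cong₂ _∧_ (lookup∘tabulate (is𝟏 ∘ g) u) (lookup∘tabulate (is𝟎 ∘ g) v))))
        (edge-test≡clash (g u) (g v)))
  ... | yes _ | no ones=∅  = sym (clash-side-empty u v (ones=∅ ∘ proj₂))
  ... | no zeros=∅ | _ = sym (clash-side-empty u v (zeros=∅ ∘ proj₁))

bicliques : ∀ {N} d → (Fin N → Vec Letter d) → List (BipClique N)
bicliques zero    w = []
bicliques (suc d) w = Coordinate.bicliques (head ∘ w) ++ bicliques d (tail ∘ w)

length-bicliques : ∀ {N} d (w : Fin N → Vec Letter d) → length (bicliques d w) ≤ d
length-bicliques zero    w = z≤n
length-bicliques (suc d) w =
  subst (_≤ suc d) (sym (length-++ (Coordinate.bicliques (head ∘ w))))
        (+-mono-≤ (Coordinate.length-bicliques (head ∘ w)) (length-bicliques d (tail ∘ w)))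

coverCount-bicliques : ∀ {N} d (w : Fin N → Vec Letter d) u v →
                       coverCount (bicliques d w) u v ≡ dist (w u) (w v)
coverCount-bicliques zero w u v with w u | w v
... | [] | [] = refl
coverCount-bicliques (suc d) w u v = begin
  coverCount (Coordinate.bicliques (head ∘ w) ++ bicliques d (tail ∘ w)) u v
    ≡⟨ coverCount-++ (Coordinate.bicliques (head ∘ w)) (bicliques d (tail ∘ w)) u v ⟩
  coverCount (Coordinate.bicliques (head ∘ w)) u v + coverCount (bicliques d (tail ∘ w)) u v
    ≡⟨ cong₂ _+_ (Coordinate.coverCount-bicliques (head ∘ w) u v) (coverCount-bicliques d (tail ∘ w) u v) ⟩
  clash (head (w u)) (head (w v)) + dist (tail (w u)) (tail (w v))
    ≡⟨ dist-head-tail (w u) (w v) ⟩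
  dist (w u) (w v) ∎
  where open ≡-Reasoning

wordCode⇒bp₂≤ : ∀ {N d} → WordCode N d → bp₂≤ N d
wordCode⇒bp₂≤ {d = d} (w , apart) =
  bicliques d w , length-bicliques d w ,
  λ u v u≢v → subst OneOrTwo (sym (coverCount-bicliques d w u v)) (apart u v u≢v)

-- Edge codes

Vertex : Set
Vertex = ℕ × ℕ

_≟ᵛ_ : DecidableEquality Vertex
_≟ᵛ_ = ≡-dec _≟_ _≟_

Graph : Set₁
Graph = Vertex → Vertex → Set

_⊆ᴳ_ : Graph → Graph → Set
H ⊆ᴳ G = ∀ a b → H a b → G a b

SameEdge : Vertex → Vertex → Vertex → Vertex → Set
SameEdge a b c e = (a ≡ c × b ≡ e) ⊎ (a ≡ e × b ≡ c)

sameEdge? : ∀ a b c e → Dec (SameEdge a b c e)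
sameEdge? a b c e = ((a ≟ᵛ c) ×-dec (b ≟ᵛ e)) ⊎-dec ((a ≟ᵛ e) ×-dec (b ≟ᵛ c))

SameEdge-sym : ∀ {a b c e} → SameEdge a b c e → SameEdge c e a b
SameEdge-sym (inj₁ (p , q)) = inj₁ (sym p , sym q)
SameEdge-sym (inj₂ (p , q)) = inj₂ (sym q , sym p)

SameEdge-reflect : ∀ {P : Vertex → Set} (f : Vertex → Vertex) →
                   (∀ {x y} → P x → P y → f x ≡ f y → x ≡ y) →
                   ∀ {a b c e} → P a → P b → P c → P e →
                   SameEdge (f a) (f b) (f c) (f e) → SameEdge a b c e
SameEdge-reflect f inj pa pb pc pe (inj₁ (p , q)) = inj₁ (inj pa pc p , inj pb pe q)
SameEdge-reflect f inj pa pb pc pe (inj₂ (p , q)) = inj₂ (inj pa pe p , inj pb pc q)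

SameEdge-trans : ∀ {a b c e x y} → SameEdge a b c e → SameEdge c e x y → SameEdge a b x y
SameEdge-trans (inj₁ (refl , refl)) q = q
SameEdge-trans (inj₂ (refl , refl)) (inj₁ (p , q)) = inj₂ (q , p)
SameEdge-trans (inj₂ (refl , refl)) (inj₂ (p , q)) = inj₁ (q , p)

SameEdge-swap : ∀ {a b c e} → SameEdge a b c e → SameEdge b a c e
SameEdge-swap (inj₁ (p , q)) = inj₂ (q , p)
SameEdge-swap (inj₂ (p , q)) = inj₁ (q , p)

DistinctEdges : Vertex → Vertex → Vertex → Vertex → Set
DistinctEdges a b c e = ¬ SameEdge a b c e

Meet : Vertex → Vertex → Vertex → Vertex → Set
Meet a b c e = (a ≡ c ⊎ a ≡ e) ⊎ (b ≡ c ⊎ b ≡ e)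

Meet-sym : ∀ {a b c e} → Meet a b c e → Meet c e a b
Meet-sym (inj₁ (inj₁ p)) = inj₁ (inj₁ (sym p))
Meet-sym (inj₁ (inj₂ p)) = inj₂ (inj₁ (sym p))
Meet-sym (inj₂ (inj₁ p)) = inj₁ (inj₂ (sym p))
Meet-sym (inj₂ (inj₂ p)) = inj₂ (inj₂ (sym p))

Meet-map : ∀ (f : Vertex → Vertex) {a b c e} → Meet a b c e → Meet (f a) (f b) (f c) (f e)
Meet-map f (inj₁ (inj₁ p)) = inj₁ (inj₁ (cong f p))
Meet-map f (inj₁ (inj₂ p)) = inj₁ (inj₂ (cong f p))
Meet-map f (inj₂ (inj₁ p)) = inj₂ (inj₁ (cong f p))
Meet-map f (inj₂ (inj₂ p)) = inj₂ (inj₂ (cong f p))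

Meet-loop : ∀ {x c e y} → Meet x x c e → Meet x y c e
Meet-loop (inj₁ m) = inj₁ m
Meet-loop (inj₂ m) = inj₁ m

Compatible : ∀ {d} → Set → Vec Letter d → Vec Letter d → Set
Compatible meet u w = OneOrTwo (dist u w) × (meet → dist u w ≡ 1)

Compatible-sym : ∀ {d} {meet meet′ : Set} {u w : Vec Letter d} →
                 (meet′ → meet) → Compatible meet u w → Compatible meet′ w u
Compatible-sym {u = u} {w} meet′⇒meet (1or2 , meet⇒1) =
  subst OneOrTwo (dist-sym u w) 1or2 , λ m → trans (dist-sym w u) (meet⇒1 (meet′⇒meet m))

record EdgeCode (G : Graph) (d : ℕ) : Set where
  field
    word        : Vertex → Vertex → Vec Letter d
    word-sym    : ∀ a b → G a b → word a b ≡ word b a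
    irreflexive : ∀ a → ¬ G a a
    compatible  : ∀ a b c e → G a b → G c e → DistinctEdges a b c e →
                  Compatible (Meet a b c e) (word a b) (word c e)
open EdgeCode public

restrict : ∀ {G H d} → H ⊆ᴳ G → EdgeCode G d → EdgeCode H d
restrict H⊆G C = record
  { word        = word C
  ; word-sym    = λ a b h → word-sym C a b (H⊆G a b h)
  ; irreflexive = λ a h → irreflexive C a (H⊆G a a h)
  ; compatible  = λ a b c e h h′ → compatible C a b c e (H⊆G a b h) (H⊆G c e h′)
  }

dist-sameEdge : ∀ {G d} (C : EdgeCode G d) {a b c e} → G a b → SameEdge a b c e →
                dist (word C a b) (word C c e) ≡ 0
dist-sameEdge C {a} {b} g (inj₁ (refl , refl)) = dist-self (word C a b)
dist-sameEdge C {a} {b} g (inj₂ (refl , refl)) =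
  trans (cong (dist (word C a b)) (sym (word-sym C a b g))) (dist-self (word C a b))

Edge : Set
Edge = Vertex × Vertex

DistinctEdgesᵉ : Rel Edge 0ℓ
DistinctEdgesᵉ (a , b) (c , e) = DistinctEdges a b c e

AllPairs-lookup : ∀ {A : Set} {R : Rel A 0ℓ} → Symmetric R → ∀ {xs} → AllPairs R xs →
                  ∀ i j → i ≢ j → R (List.lookup xs i) (List.lookup xs j)
AllPairs-lookup R-sym (Rx ∷ Rxs) zero    zero    i≢j = ⊥-elim (i≢j refl)
AllPairs-lookup R-sym (Rx ∷ Rxs) zero    (suc j) i≢j = All.lookup Rx (∈-lookup j)
AllPairs-lookup R-sym (Rx ∷ Rxs) (suc i) zero    i≢j = R-sym (All.lookup Rx (∈-lookup i))
AllPairs-lookup R-sym (Rx ∷ Rxs) (suc i) (suc j) i≢j = AllPairs-lookup R-sym Rxs i j (i≢j ∘ cong suc)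

edgeList⇒wordCode : ∀ {G d N} → EdgeCode G d → (es : List Edge) → All (uncurry G) es →
                    AllPairs DistinctEdgesᵉ es → N ≤ length es → WordCode N d
edgeList⇒wordCode {G} {d} {N} C es es⊆G es-distinct N≤ = uncurry (word C) ∘ edge , apart
  where
  edge : Fin N → Edge
  edge u = List.lookup es (inject≤ u N≤)

  apart : ∀ u v → u ≢ v → OneOrTwo (dist (uncurry (word C) (edge u)) (uncurry (word C) (edge v)))
  apart u v u≢v = proj₁ (compatible C _ _ _ _ (All.lookup es⊆G (∈-lookup _)) (All.lookup es⊆G (∈-lookup _))
    (AllPairs-lookup (λ ne → ne ∘ SameEdge-sym) es-distinct _ _ (u≢v ∘ inject≤-injective N≤ N≤ u v)))

-- Twins

Avoids : Vertex → Vertex → Vertex → Set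
Avoids z a b = a ≢ z × b ≢ z

pick : Letter → Letter → Letter
pick ⋆ y = y
pick x _ = x

pick-⋆ʳ : ∀ x → pick x ⋆ ≡ x
pick-⋆ʳ 𝟎 = refl
pick-⋆ʳ 𝟏 = refl
pick-⋆ʳ ⋆ = refl

module Twin {G : Graph} {d : ℕ} (C : EdgeCode G d) (v v′ : Vertex) (v≢v′ : v ≢ v′) where

  ρ : Vertex → Vertex
  ρ x with x ≟ᵛ v′
  ... | yes _ = v
  ... | no  _ = x

  ρ-cases : ∀ x → (x ≡ v′ × ρ x ≡ v) ⊎ (x ≢ v′ × ρ x ≡ x)
  ρ-cases x with x ≟ᵛ v′
  ... | yes x≡v′ = inj₁ (x≡v′ , refl)
  ... | no  x≢v′ = inj₂ (x≢v′ , refl)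

  ρ-v′ : ρ v′ ≡ v
  ρ-v′ with v′ ≟ᵛ v′
  ... | yes _    = refl
  ... | no v′≢v′ = ⊥-elim (v′≢v′ refl)

  ρ-fixed : ∀ {x} → x ≢ v′ → ρ x ≡ x
  ρ-fixed {x} x≢v′ with x ≟ᵛ v′
  ... | yes x≡v′ = ⊥-elim (x≢v′ x≡v′)
  ... | no  _    = refl

  ρ-v : ρ v ≡ v
  ρ-v = ρ-fixed v≢v′

  ρ-injective-off-v : ∀ {x y} → x ≢ v → y ≢ v → ρ x ≡ ρ y → x ≡ y
  ρ-injective-off-v {x} {y} x≢v y≢v ρx≡ρy with x ≟ᵛ v′ | y ≟ᵛ v′
  ... | yes x≡v′ | yes y≡v′ = trans x≡v′ (sym y≡v′)
  ... | yes _    | no  _    = ⊥-elim (y≢v (sym ρx≡ρy))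
  ... | no  _    | yes _    = ⊥-elim (x≢v ρx≡ρy)
  ... | no  _    | no  _    = ρx≡ρy

  ρ-injective-off-v′ : ∀ {x y} → x ≢ v′ → y ≢ v′ → ρ x ≡ ρ y → x ≡ y
  ρ-injective-off-v′ x≢v′ y≢v′ ρx≡ρy = trans (sym (ρ-fixed x≢v′)) (trans ρx≡ρy (ρ-fixed y≢v′))

  data SideView (x : Vertex) : Set where
    is-v  : x ≡ v → SideView x
    is-v′ : x ≡ v′ → SideView x
    other : x ≢ v → x ≢ v′ → SideView x

  sideView : ∀ x → SideView x
  sideView x with x ≟ᵛ v | x ≟ᵛ v′
  ... | yes x≡v | _        = is-v x≡v
  ... | no  _   | yes x≡v′ = is-v′ x≡v′
  ... | no x≢v  | no x≢v′  = other x≢v x≢v′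

  side : Vertex → Letter
  side x with sideView x
  ... | is-v  _   = 𝟎
  ... | is-v′ _   = 𝟏
  ... | other _ _ = ⋆

  side-v : side v ≡ 𝟎
  side-v with sideView v
  ... | is-v  _     = refl
  ... | is-v′ v≡v′  = ⊥-elim (v≢v′ v≡v′)
  ... | other v≢v _ = ⊥-elim (v≢v refl)

  side-v′ : side v′ ≡ 𝟏
  side-v′ with sideView v′
  ... | is-v  v′≡v    = ⊥-elim (v≢v′ (sym v′≡v))
  ... | is-v′ _       = refl
  ... | other _ v′≢v′ = ⊥-elim (v′≢v′ refl)

  side-other : ∀ {x} → x ≢ v → x ≢ v′ → side x ≡ ⋆
  side-other {x} x≢v x≢v′ with sideView x
  ... | is-v  x≡v  = ⊥-elim (x≢v x≡v)
  ... | is-v′ x≡v′ = ⊥-elim (x≢v′ x≡v′)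
  ... | other _ _  = refl

  mark : Vertex → Vertex → Letter
  mark a b = pick (side a) (side b)

  twinGraph : Graph
  twinGraph a b = G (ρ a) (ρ b)

  twinWord : Vertex → Vertex → Vec Letter (suc d)
  twinWord a b = mark a b ∷ word C (ρ a) (ρ b)

  ρ-twins : ∀ {x} → x ≡ v ⊎ x ≡ v′ → ρ x ≡ v
  ρ-twins (inj₁ refl) = ρ-v
  ρ-twins (inj₂ refl) = ρ-v′

  not-both-twins : ∀ {a b} → twinGraph a b → a ≡ v ⊎ a ≡ v′ → b ≡ v ⊎ b ≡ v′ → ⊥
  not-both-twins g a-twin b-twin = irreflexive C v (subst₂ G (ρ-twins a-twin) (ρ-twins b-twin) g)

  data Position (a b : Vertex) : Set where
    at-v  : a ≡ v ⊎ b ≡ v → Avoids v′ a b → mark a b ≡ 𝟎 → Position a b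
    at-v′ : a ≡ v′ ⊎ b ≡ v′ → Avoids v a b → mark a b ≡ 𝟏 → Position a b
    away  : Avoids v a b → Avoids v′ a b → mark a b ≡ ⋆ → Position a b

  position : ∀ {a b} → twinGraph a b → Position a b
  position {a} {b} g with sideView a | sideView b
  ... | is-v  p     | is-v  q     = ⊥-elim (not-both-twins g (inj₁ p) (inj₁ q))
  ... | is-v  p     | is-v′ q     = ⊥-elim (not-both-twins g (inj₁ p) (inj₂ q))
  ... | is-v′ p     | is-v  q     = ⊥-elim (not-both-twins g (inj₂ p) (inj₁ q))
  ... | is-v′ p     | is-v′ q     = ⊥-elim (not-both-twins g (inj₂ p) (inj₂ q))
  ... | is-v  refl  | other q q′  = at-v (inj₁ refl) (v≢v′ , q′) (cong (λ s → pick s (side b)) side-v)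
  ... | is-v′ refl  | other q q′  = at-v′ (inj₁ refl) (v≢v′ ∘ sym , q) (cong (λ s → pick s (side b)) side-v′)
  ... | other p p′  | is-v  refl  =
    at-v (inj₂ refl) (p′ , v≢v′) (trans (cong (λ s → pick s (side v)) (side-other p p′)) side-v)
  ... | other p p′  | is-v′ refl  =
    at-v′ (inj₂ refl) (p , v≢v′ ∘ sym) (trans (cong (λ s → pick s (side v′)) (side-other p p′)) side-v′)
  ... | other p p′  | other q q′  =
    away (p , q) (p′ , q′) (trans (cong (λ s → pick s (side b)) (side-other p p′)) (side-other q q′))

  away-or-twin : ∀ x → side x ≡ ⋆ ⊎ (x ≡ v ⊎ x ≡ v′)
  away-or-twin x with sideView x
  ... | is-v  x≡v  = inj₂ (inj₁ x≡v)
  ... | is-v′ x≡v′ = inj₂ (inj₂ x≡v′)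
  ... | other _ _  = inj₁ refl

  mark-sym : ∀ {a b} → twinGraph a b → mark a b ≡ mark b a
  mark-sym {a} {b} g with away-or-twin a | away-or-twin b
  ... | _          | inj₁ b-away rewrite b-away = pick-⋆ʳ (side a)
  ... | inj₁ a-away | _         rewrite a-away = sym (pick-⋆ʳ (side b))
  ... | inj₂ a-twin | inj₂ b-twin = ⊥-elim (not-both-twins g a-twin b-twin)

  images-meet : ∀ {a b c e} → a ≡ v ⊎ b ≡ v → c ≡ v′ ⊎ e ≡ v′ → Meet (ρ a) (ρ b) (ρ c) (ρ e)
  images-meet (inj₁ refl) (inj₁ refl) = inj₁ (inj₁ (trans ρ-v (sym ρ-v′)))
  images-meet (inj₁ refl) (inj₂ refl) = inj₁ (inj₂ (trans ρ-v (sym ρ-v′)))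
  images-meet (inj₂ refl) (inj₁ refl) = inj₂ (inj₁ (trans ρ-v (sym ρ-v′)))
  images-meet (inj₂ refl) (inj₂ refl) = inj₂ (inj₂ (trans ρ-v (sym ρ-v′)))

  -- Edges at v and at v′ can only meet in a common neighbour x, and then both fold onto v x.
  meet⇒same-image : ∀ {a b c e} → a ≡ v ⊎ b ≡ v → Avoids v′ a b → c ≡ v′ ⊎ e ≡ v′ → Avoids v c e →
                    Meet a b c e → SameEdge (ρ a) (ρ b) (ρ c) (ρ e)
  meet⇒same-image (inj₁ refl) _ (inj₁ refl) _ (inj₁ (inj₁ p)) = ⊥-elim (v≢v′ p)
  meet⇒same-image (inj₁ refl) _ (inj₁ refl) (_ , e≢v) (inj₁ (inj₂ p)) = ⊥-elim (e≢v (sym p))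
  meet⇒same-image (inj₁ refl) (_ , b≢v′) (inj₁ refl) _ (inj₂ (inj₁ p)) = ⊥-elim (b≢v′ p)
  meet⇒same-image (inj₁ refl) _ (inj₁ refl) _ (inj₂ (inj₂ p)) = inj₁ (trans ρ-v (sym ρ-v′) , cong ρ p)
  meet⇒same-image (inj₁ refl) _ (inj₂ refl) (c≢v , _) (inj₁ (inj₁ p)) = ⊥-elim (c≢v (sym p))
  meet⇒same-image (inj₁ refl) _ (inj₂ refl) _ (inj₁ (inj₂ p)) = ⊥-elim (v≢v′ p)
  meet⇒same-image (inj₁ refl) _ (inj₂ refl) _ (inj₂ (inj₁ p)) = inj₂ (trans ρ-v (sym ρ-v′) , cong ρ p)
  meet⇒same-image (inj₁ refl) (_ , b≢v′) (inj₂ refl) _ (inj₂ (inj₂ p)) = ⊥-elim (b≢v′ p)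
  meet⇒same-image (inj₂ refl) (a≢v′ , _) (inj₁ refl) _ (inj₁ (inj₁ p)) = ⊥-elim (a≢v′ p)
  meet⇒same-image (inj₂ refl) _ (inj₁ refl) _ (inj₁ (inj₂ p)) = inj₂ (cong ρ p , trans ρ-v (sym ρ-v′))
  meet⇒same-image (inj₂ refl) _ (inj₁ refl) _ (inj₂ (inj₁ p)) = ⊥-elim (v≢v′ p)
  meet⇒same-image (inj₂ refl) _ (inj₁ refl) (_ , e≢v) (inj₂ (inj₂ p)) = ⊥-elim (e≢v (sym p))
  meet⇒same-image (inj₂ refl) _ (inj₂ refl) _ (inj₁ (inj₁ p)) = inj₁ (cong ρ p , trans ρ-v (sym ρ-v′))
  meet⇒same-image (inj₂ refl) (a≢v′ , _) (inj₂ refl) _ (inj₁ (inj₂ p)) = ⊥-elim (a≢v′ p)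
  meet⇒same-image (inj₂ refl) _ (inj₂ refl) (c≢v , _) (inj₂ (inj₁ p)) = ⊥-elim (c≢v (sym p))
  meet⇒same-image (inj₂ refl) _ (inj₂ refl) _ (inj₂ (inj₂ p)) = ⊥-elim (v≢v′ p)

  -- Edges with equal or ⋆ new letters both avoid v′ (or both avoid v), and ρ is injective
  -- off either twin, so their images are still distinct edges of G.
  unchanged : ∀ z → (∀ {x y} → x ≢ z → y ≢ z → ρ x ≡ ρ y → x ≡ y) →
              ∀ {a b c e} → twinGraph a b → twinGraph c e → DistinctEdges a b c e →
              Avoids z a b → Avoids z c e → clash (mark a b) (mark c e) ≡ 0 →
              Compatible (Meet a b c e) (twinWord a b) (twinWord c e)
  unchanged z ρ-injective g h distinct (p , q) (r , s) no-clash rewrite no-clash =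
    let (1or2 , meet⇒1) = compatible C _ _ _ _ g h (distinct ∘ SameEdge-reflect ρ ρ-injective p q r s)
    in 1or2 , meet⇒1 ∘ Meet-map ρ
  -- An edge at v and an edge at v′ clash in the new coordinate; their images share v,
  -- so they were at distance 1 unless they fold onto the same edge.
  across : ∀ {a b c e} → twinGraph a b → twinGraph c e →
           a ≡ v ⊎ b ≡ v → Avoids v′ a b → mark a b ≡ 𝟎 → c ≡ v′ ⊎ e ≡ v′ → Avoids v c e → mark c e ≡ 𝟏 →
           Compatible (Meet a b c e) (twinWord a b) (twinWord c e)
  across {a} {b} {c} {e} g h touches-v avoids-v′ mark𝟎 touches-v′ avoids-v mark𝟏 rewrite mark𝟎 | mark𝟏
    with sameEdge? (ρ a) (ρ b) (ρ c) (ρ e)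
  ... | yes same rewrite dist-sameEdge C g same = (s≤s z≤n , s≤s z≤n) , λ _ → refl
  ... | no distinct rewrite proj₂ (compatible C _ _ _ _ g h distinct) (images-meet touches-v touches-v′) =
    (s≤s z≤n , s≤s (s≤s z≤n)) ,
    λ meet → ⊥-elim (distinct (meet⇒same-image touches-v avoids-v′ touches-v′ avoids-v meet))

  twin-compatible : ∀ a b c e → twinGraph a b → twinGraph c e → DistinctEdges a b c e →
                    Compatible (Meet a b c e) (twinWord a b) (twinWord c e)
  twin-compatible a b c e g h distinct with position g | position h
  ... | at-v  p α m | at-v′ q β n = across g h p α m q β n
  ... | at-v′ p α m | at-v  q β n =
    Compatible-sym {u = twinWord c e} {twinWord a b} Meet-sym (across h g q β n p α m)
  ... | at-v  _ α m | at-v  _ β n = unchanged v′ ρ-injective-off-v′ g h distinct α β (cong₂ clash m n)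
  ... | at-v  _ α m | away  _ β n = unchanged v′ ρ-injective-off-v′ g h distinct α β (cong₂ clash m n)
  ... | away  _ α m | at-v  _ β n = unchanged v′ ρ-injective-off-v′ g h distinct α β (cong₂ clash m n)
  ... | away  _ α m | away  _ β n = unchanged v′ ρ-injective-off-v′ g h distinct α β (cong₂ clash m n)
  ... | at-v′ _ α m | at-v′ _ β n = unchanged v  ρ-injective-off-v  g h distinct α β (cong₂ clash m n)
  ... | at-v′ _ α m | away  β _ n = unchanged v  ρ-injective-off-v  g h distinct α β (cong₂ clash m n)
  ... | away  α _ m | at-v′ _ β n = unchanged v  ρ-injective-off-v  g h distinct α β (cong₂ clash m n)

  twin : EdgeCode twinGraph (suc d)
  twin = record
    { word        = twinWord
    ; word-sym    = λ a b g → cong₂ _∷_ (mark-sym g) (word-sym C (ρ a) (ρ b) g)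
    ; irreflexive = λ a → irreflexive C (ρ a)
    ; compatible  = twin-compatible
    }

-- As a twin, but the edge i c′ is traded for the edge i w between the twins, which
-- inherits the word of i c′.
module Transfer {G : Graph} {d : ℕ} (C : EdgeCode G d) (i w c′ : Vertex) (i≢w : i ≢ w) (g-ic′ : G i c′) where
  open Twin C i w i≢w public

  transferGraph : Graph
  transferGraph a b = SameEdge a b i w ⊎ (twinGraph a b × DistinctEdges (ρ a) (ρ b) i c′)

  transferWord : Vertex → Vertex → Vec Letter (suc d)
  transferWord a b with sameEdge? a b i w
  ... | yes _ = ⋆ ∷ word C i c′
  ... | no  _ = twinWord a b

  transferWord-new : ∀ {a b} → SameEdge a b i w → transferWord a b ≡ ⋆ ∷ word C i c′
  transferWord-new {a} {b} new with sameEdge? a b i w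
  ... | yes _   = refl
  ... | no  old = ⊥-elim (old new)

  transferWord-old : ∀ {a b} → DistinctEdges a b i w → transferWord a b ≡ twinWord a b
  transferWord-old {a} {b} old with sameEdge? a b i w
  ... | yes new = ⊥-elim (old new)
  ... | no  _   = refl

  new-edge-folds : ∀ {a b} → SameEdge a b i w → ρ a ≡ i × ρ b ≡ i
  new-edge-folds (inj₁ (refl , refl)) = ρ-v , ρ-v′
  new-edge-folds (inj₂ (refl , refl)) = ρ-v′ , ρ-v

  new-edge-not-twin : ∀ {a b} → twinGraph a b → DistinctEdges a b i w
  new-edge-not-twin g new with new-edge-folds new
  ... | ρa≡i , ρb≡i = irreflexive C i (subst₂ G ρa≡i ρb≡i g)

  new-vs-old : ∀ {a b c e} → SameEdge a b i w → twinGraph c e → DistinctEdges (ρ c) (ρ e) i c′ →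
               Compatible (Meet a b c e) (transferWord a b) (transferWord c e)
  new-vs-old {a} {b} {c} {e} new h ce≠ic′
    rewrite transferWord-new new | transferWord-old (new-edge-not-twin h) =
    let (1or2 , meet⇒1) = compatible C i c′ (ρ c) (ρ e) g-ic′ h (ce≠ic′ ∘ SameEdge-sym) in
    1or2 , λ meet → meet⇒1 (Meet-loop (subst₂ (λ x y → Meet x y (ρ c) (ρ e))
                                              (proj₁ (new-edge-folds new)) (proj₂ (new-edge-folds new))
                                              (Meet-map ρ meet)))

  transfer-compatible : ∀ a b c e → transferGraph a b → transferGraph c e → DistinctEdges a b c e →
                        Compatible (Meet a b c e) (transferWord a b) (transferWord c e)
  transfer-compatible a b c e (inj₁ new) (inj₁ new′) distinct =
    ⊥-elim (distinct (SameEdge-trans new (SameEdge-sym new′)))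
  transfer-compatible a b c e (inj₁ new) (inj₂ (h , ce≠ic′)) _ = new-vs-old new h ce≠ic′
  transfer-compatible a b c e (inj₂ (g , ab≠ic′)) (inj₁ new) _ =
    Compatible-sym {u = transferWord c e} {transferWord a b} Meet-sym (new-vs-old new g ab≠ic′)
  transfer-compatible a b c e (inj₂ (g , _)) (inj₂ (h , _)) distinct
    rewrite transferWord-old (new-edge-not-twin g) | transferWord-old (new-edge-not-twin h) =
    twin-compatible a b c e g h distinct

  transferWord-sym : ∀ a b → transferGraph a b → transferWord a b ≡ transferWord b a
  transferWord-sym a b (inj₁ new) = trans (transferWord-new new) (sym (transferWord-new (SameEdge-swap new)))
  transferWord-sym a b (inj₂ (g , _)) =
    trans (transferWord-old (new-edge-not-twin g))
          (trans (word-sym twin a b g) (sym (transferWord-old (new-edge-not-twin g ∘ SameEdge-swap))))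

  transfer-irreflexive : ∀ a → ¬ transferGraph a a
  transfer-irreflexive a (inj₁ (inj₁ (refl , i≡w))) = i≢w i≡w
  transfer-irreflexive a (inj₁ (inj₂ (i≡w , refl))) = i≢w i≡w
  transfer-irreflexive a (inj₂ (g , _))             = irreflexive C (ρ a) g

  transfer : EdgeCode transferGraph (suc d)
  transfer = record
    { word        = transferWord
    ; word-sym    = transferWord-sym
    ; irreflexive = transfer-irreflexive
    ; compatible  = transfer-compatible
    }

-- Complete multipartite graphs

-- Vertex (y , j) lies in layer y and part j: layers below t are full (parts 0 … M-1),
-- layer t holds parts 0 … i-1.
InLayers : ℕ → ℕ → ℕ → Vertex → Set
InLayers M t i (y , j) = (y < t × j < M) ⊎ (y ≡ t × j < i)

Multipartite : ℕ → ℕ → ℕ → Graph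
Multipartite M t i a b = InLayers M t i a × InLayers M t i b × proj₂ a ≢ proj₂ b

Complete : ℕ → Graph
Complete M = Multipartite M 1 0

InLayers-suc : ∀ {M t i x} → InLayers M t i x → InLayers M t (suc i) x
InLayers-suc (inj₁ lower)         = inj₁ lower
InLayers-suc (inj₂ (y≡t , j<i)) = inj₂ (y≡t , m<n⇒m<1+n j<i)

InLayers-next : ∀ {M t x} → InLayers M t M x → InLayers M (suc t) 0 x
InLayers-next (inj₁ (y<t , j<M))  = inj₁ (m<n⇒m<1+n y<t , j<M)
InLayers-next (inj₂ (refl , j<M)) = inj₁ (n<1+n _ , j<M)

fresh : ∀ {M t i} → ¬ InLayers M t i (t , i)
fresh (inj₁ (t<t , _)) = n≮n _ t<t
fresh (inj₂ (_ , i<i)) = n≮n _ i<i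

grow : ∀ {M t i d} → i < M → EdgeCode (Multipartite M (suc t) i) d →
       EdgeCode (Multipartite M (suc t) (suc i)) (suc d)
grow {M} {t} {i} i<M C = restrict ⊆twinGraph twin
  where
  open Twin C (t , i) (suc t , i) (λ ())

  ρ-part : ∀ a → proj₂ (ρ a) ≡ proj₂ a
  ρ-part a with ρ-cases a
  ... | inj₁ (refl , ρa≡v) = cong proj₂ ρa≡v
  ... | inj₂ (_    , ρa≡a) = cong proj₂ ρa≡a

  shrink : ∀ a → InLayers M (suc t) (suc i) a → a ≢ (suc t , i) → InLayers M (suc t) i a
  shrink (y , j) (inj₁ lower)         _  = inj₁ lower
  shrink (y , j) (inj₂ (refl , j≤i)) a≢v′ = inj₂ (refl , ≤∧≢⇒< (≤-pred j≤i) (a≢v′ ∘ cong (suc t ,_)))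

  ρ-in : ∀ a → InLayers M (suc t) (suc i) a → InLayers M (suc t) i (ρ a)
  ρ-in a a∈ with ρ-cases a
  ... | inj₁ (refl , ρa≡v) = subst (InLayers M (suc t) i) (sym ρa≡v) (inj₁ (n<1+n t , i<M))
  ... | inj₂ (a≢v′ , ρa≡a) = subst (InLayers M (suc t) i) (sym ρa≡a) (shrink a a∈ a≢v′)

  ⊆twinGraph : Multipartite M (suc t) (suc i) ⊆ᴳ twinGraph
  ⊆twinGraph a b (a∈ , b∈ , parts≢) =
    ρ-in a a∈ , ρ-in b b∈ , λ eq → parts≢ (trans (sym (ρ-part a)) (trans eq (ρ-part b)))

next-layer : ∀ {M t d} → EdgeCode (Multipartite M t M) d → EdgeCode (Multipartite M (suc t) 0) d
next-layer {M} {t} = restrict λ a b (a∈ , b∈ , parts≢) → full a a∈ , full b b∈ , parts≢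
  where
  full : ∀ x → InLayers M (suc t) 0 x → InLayers M t M x
  full (y , j) (inj₁ (s≤s y≤t , j<M)) with y ≟ t
  ... | yes refl = inj₂ (refl , j<M)
  ... | no  y≢t  = inj₁ (≤∧≢⇒< y≤t y≢t , j<M)

multipartite : ∀ {M D} → EdgeCode (Complete M) D →
               ∀ t i → i ≤ M → EdgeCode (Multipartite M (suc t) i) (t * M + i + D)
multipartite C zero    zero    _   = C
multipartite {M} {D} C (suc t) zero _ =
  subst (EdgeCode (Multipartite M (suc (suc t)) 0))
        (cong (_+ D) (trans (+-comm (t * M) M) (sym (+-identityʳ (M + t * M)))))
        (next-layer (multipartite C t M ≤-refl))
multipartite {M} {D} C t (suc i) i<M =
  subst (EdgeCode (Multipartite M (suc t) (suc i))) (cong (_+ D) (sym (+-suc (t * M) i)))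
        (grow i<M (multipartite C t i (<⇒≤ i<M)))

K₂ : EdgeCode (Complete 2) 0
K₂ = record
  { word        = λ _ _ → []
  ; word-sym    = λ _ _ _ → refl
  ; irreflexive = λ _ (_ , _ , parts≢) → parts≢ refl
  ; compatible  = λ a b c e g h distinct → ⊥-elim (distinct (one-edge g h))
  }
  where
  vertex : ∀ {x} → InLayers 2 1 0 x → x ≡ (0 , 0) ⊎ x ≡ (0 , 1)
  vertex {0 , 0} (inj₁ (s≤s z≤n , _)) = inj₁ refl
  vertex {0 , 1} (inj₁ (s≤s z≤n , _)) = inj₂ refl
  vertex {0 , suc (suc _)} (inj₁ (_ , s≤s (s≤s ())))
  vertex {suc _ , _} (inj₁ (s≤s () , _))

  one-edge : ∀ {a b c e} → Complete 2 a b → Complete 2 c e → SameEdge a b c e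
  one-edge (a∈ , b∈ , ab) (c∈ , e∈ , ce) with vertex a∈ | vertex b∈ | vertex c∈ | vertex e∈
  ... | inj₁ refl | inj₁ refl | _         | _         = ⊥-elim (ab refl)
  ... | inj₂ refl | inj₂ refl | _         | _         = ⊥-elim (ab refl)
  ... | _         | _         | inj₁ refl | inj₁ refl = ⊥-elim (ce refl)
  ... | _         | _         | inj₂ refl | inj₂ refl = ⊥-elim (ce refl)
  ... | inj₁ refl | inj₂ refl | inj₁ refl | inj₂ refl = inj₁ (refl , refl)
  ... | inj₁ refl | inj₂ refl | inj₂ refl | inj₁ refl = inj₂ (refl , refl)
  ... | inj₂ refl | inj₁ refl | inj₁ refl | inj₂ refl = inj₂ (refl , refl)
  ... | inj₂ refl | inj₁ refl | inj₂ refl | inj₁ refl = inj₁ (refl , refl)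

-- K_{m+1} lives in layer 0 of Complete (suc m).  The last vertex c = (0 , m) first gets
-- a twin c′ = (1 , 0); then for j = 0 … m-1 the edge (0 , j) c′ is transferred to the
-- edge between (0 , j) and its new twin (0 , j + m + 1), leaving c′ isolated.
module Doubling (m : ℕ) {D : ℕ} (C : EdgeCode (Complete (suc m)) D) where

  c′ : Vertex
  c′ = (1 , 0)

  Row : ℕ → Vertex → Set
  Row n (y , x) = y ≡ 0 × x < n

  Pendant : ℕ → Vertex → Vertex → Set
  Pendant j (y , x) b = y ≡ 0 × j ≤ x × x < m × b ≡ c′

  -- The graph after j transfers: the pendant edges (0 , x) c′ with x < j are traded away.
  Partial : ℕ → Graph
  Partial j a b = (Row (j + suc m) a × Row (j + suc m) b × a ≢ b) ⊎ (Pendant j a b ⊎ Pendant j b a)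

  row-parts : ∀ {n a b} → Row n a → Row n b → a ≢ b → proj₂ a ≢ proj₂ b
  row-parts {a = _ , _} {_ , _} (refl , _) (refl , _) a≢b refl = a≢b refl

  row≢c′ : ∀ {n a} → Row n a → a ≢ c′
  row≢c′ (refl , _) ()

  module First where
    open Twin C (0 , m) c′ (λ ()) public

    complete : ∀ {a} → Row (suc m) a → InLayers (suc m) 1 0 a
    complete (refl , x<) = inj₁ (s≤s z≤n , x<)

    partial₀⊆twinGraph : Partial 0 ⊆ᴳ twinGraph
    partial₀⊆twinGraph a b (inj₁ (a∈ , b∈ , a≢b)) =
      subst₂ (Complete (suc m)) (sym (ρ-fixed (row≢c′ a∈))) (sym (ρ-fixed (row≢c′ b∈)))
             (complete a∈ , complete b∈ , row-parts a∈ b∈ a≢b)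
    partial₀⊆twinGraph (_ , x) b (inj₂ (inj₁ (refl , _ , x<m , refl))) =
      subst₂ (Complete (suc m)) (sym (ρ-fixed (row≢c′ {a = 0 , x} (refl , x<m)))) (sym ρ-v′)
             (complete (refl , <-trans x<m (n<1+n m)) , complete (refl , n<1+n m) , <⇒≢ x<m)
    partial₀⊆twinGraph a (_ , x) (inj₂ (inj₂ (refl , _ , x<m , refl))) =
      subst₂ (Complete (suc m)) (sym ρ-v′) (sym (ρ-fixed (row≢c′ {a = 0 , x} (refl , x<m))))
             (complete (refl , n<1+n m) , complete (refl , <-trans x<m (n<1+n m)) , <⇒≢ x<m ∘ sym)

  module Next (j : ℕ) (j<m : j < m) {E : ℕ} (Cⱼ : EdgeCode (Partial j) E) where
    i w : Vertex
    i = (0 , j)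
    w = (0 , j + suc m)

    j<j+m+1 : j < j + suc m
    j<j+m+1 = m<m+n j (s≤s z≤n)

    below-m≢w : ∀ {x} → x < m → (0 , x) ≢ w
    below-m≢w x<m eq = <⇒≢ (<-≤-trans x<m (≤-trans (n≤1+n m) (m≤n+m (suc m) j))) (cong proj₂ eq)

    open Transfer Cⱼ i w c′ (<⇒≢ j<j+m+1 ∘ cong proj₂) (inj₂ (inj₁ (refl , ≤-refl , j<m , refl))) public

    ρ-row : ∀ {a} → Row (suc j + suc m) a → Row (j + suc m) (ρ a)
    ρ-row {a} a∈ with ρ-cases a
    ... | inj₁ (refl , ρa≡i) = subst (Row (j + suc m)) (sym ρa≡i) (refl , j<j+m+1)
    ... | inj₂ (a≢w , ρa≡a) = subst (Row (j + suc m)) (sym ρa≡a) (shrink a∈ a≢w)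
      where
      shrink : ∀ {a} → Row (suc j + suc m) a → a ≢ w → Row (j + suc m) a
      shrink {_ , x} (refl , x<) a≢w = refl , ≤∧≢⇒< (≤-pred x<) (a≢w ∘ cong (0 ,_))

    ρ-distinct : ∀ {a b} → a ≢ b → DistinctEdges a b i w → ρ a ≢ ρ b
    ρ-distinct {a} {b} a≢b ab≠iw ρa≡ρb with ρ-cases a | ρ-cases b
    ... | inj₁ (a≡w , _)    | inj₁ (b≡w , _)    = a≢b (trans a≡w (sym b≡w))
    ... | inj₁ (a≡w , ρa≡i) | inj₂ (_ , ρb≡b)   = ab≠iw (inj₂ (a≡w , trans (sym ρb≡b) (trans (sym ρa≡ρb) ρa≡i)))
    ... | inj₂ (_ , ρa≡a)   | inj₁ (b≡w , ρb≡i) = ab≠iw (inj₁ (trans (sym ρa≡a) (trans ρa≡ρb ρb≡i) , b≡w))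
    ... | inj₂ (_ , ρa≡a)   | inj₂ (_ , ρb≡b)   = a≢b (trans (sym ρa≡a) (trans ρa≡ρb ρb≡b))

    row-not-c′-edge : ∀ {n a b} → Row n a → Row n b → DistinctEdges a b i c′
    row-not-c′-edge a∈ b∈ (inj₁ (_ , b≡c′)) = row≢c′ b∈ b≡c′
    row-not-c′-edge a∈ b∈ (inj₂ (a≡c′ , _)) = row≢c′ a∈ a≡c′

    pendant-kept : ∀ {x} → j < x → x < m →
                   Partial j (ρ (0 , x)) (ρ c′) × DistinctEdges (ρ (0 , x)) (ρ c′) i c′
    pendant-kept j<x x<m rewrite ρ-fixed (below-m≢w x<m) | ρ-fixed {c′} (λ ()) =
      inj₂ (inj₁ (refl , <⇒≤ j<x , x<m , refl)) ,
      λ { (inj₁ (x≡j , _)) → <⇒≢ j<x (sym (cong proj₂ x≡j)) ; (inj₂ (() , _)) }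

    pendant-kept′ : ∀ {x} → j < x → x < m →
                    Partial j (ρ c′) (ρ (0 , x)) × DistinctEdges (ρ c′) (ρ (0 , x)) i c′
    pendant-kept′ j<x x<m rewrite ρ-fixed (below-m≢w x<m) | ρ-fixed {c′} (λ ()) =
      inj₂ (inj₂ (refl , <⇒≤ j<x , x<m , refl)) ,
      λ { (inj₁ (() , _)) ; (inj₂ (_ , x≡j)) → <⇒≢ j<x (sym (cong proj₂ x≡j)) }

    partial⊆transferGraph : Partial (suc j) ⊆ᴳ transferGraph
    partial⊆transferGraph a b (inj₁ (a∈ , b∈ , a≢b)) with sameEdge? a b i w
    ... | yes new = inj₁ new
    ... | no  old =
      inj₂ (inj₁ (ρ-row a∈ , ρ-row b∈ , ρ-distinct a≢b old) , row-not-c′-edge (ρ-row a∈) (ρ-row b∈))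
    partial⊆transferGraph (_ , x) _ (inj₂ (inj₁ (refl , j<x , x<m , refl))) = inj₂ (pendant-kept j<x x<m)
    partial⊆transferGraph _ (_ , x) (inj₂ (inj₂ (refl , j<x , x<m , refl))) = inj₂ (pendant-kept′ j<x x<m)

  partials : ∀ j → j ≤ m → EdgeCode (Partial j) (j + suc D)
  partials zero    _   = restrict First.partial₀⊆twinGraph First.twin
  partials (suc j) j<m = restrict partial⊆transferGraph transfer
    where open Next j j<m (partials j (<⇒≤ j<m))

  complete⊆partial : Complete (m + suc m) ⊆ᴳ Partial m
  complete⊆partial (_ , _) (_ , _) (inj₁ (s≤s z≤n , x<) , inj₁ (s≤s z≤n , x′<) , parts≢) =
    inj₁ ((refl , x<) , (refl , x′<) , parts≢ ∘ cong proj₂)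
  complete⊆partial _ _ (inj₂ (_ , ()) , _ , _)
  complete⊆partial _ _ (_ , inj₂ (_ , ()) , _)

  doubled : EdgeCode (Complete (m + suc m)) (m + suc D)
  doubled = restrict complete⊆partial (partials m ≤-refl)

seedDim : ℕ → ℕ
seedDim zero    = 0
seedDim (suc k) = 2 ^ k + suc (seedDim k)

seed : ∀ k → EdgeCode (Complete (suc (2 ^ k))) (seedDim k)
seed zero    = K₂
seed (suc k) = subst (λ M → EdgeCode (Complete M) (seedDim (suc k)))
                     (trans (+-suc (2 ^ k) (2 ^ k)) (cong (λ n → suc (2 ^ k + n)) (sym (+-identityʳ (2 ^ k)))))
                     (Doubling.doubled (2 ^ k) (seed k))

-- Counting edges

otherParts : ℕ → ℕ → List ℕ
otherParts m i = upTo i ++ applyUpTo (λ k → suc (i + k)) (m ∸ i)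

length-otherParts : ∀ {m i} → i ≤ m → length (otherParts m i) ≡ m
length-otherParts {m} {i} i≤m = begin
  length (upTo i ++ applyUpTo _ (m ∸ i))              ≡⟨ length-++ (upTo i) ⟩
  length (upTo i) + length (applyUpTo _ (m ∸ i))      ≡⟨ cong₂ _+_ (length-upTo i) (length-applyUpTo _ (m ∸ i)) ⟩
  i + (m ∸ i)                                         ≡⟨ m+[n∸m]≡n i≤m ⟩
  m                                                   ∎
  where open ≡-Reasoning

all-otherParts : ∀ {m i} → i ≤ m → All (λ j → j ≤ m × j ≢ i) (otherParts m i)
all-otherParts {m} {i} i≤m = All.++⁺
  (All.map (λ j<i → ≤-trans (<⇒≤ j<i) i≤m , <⇒≢ j<i) (All.all-upTo i))
  (All.applyUpTo⁺₁ _ (m ∸ i) λ {k} k<m-i →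
     subst (suc (i + k) ≤_) (m+[n∸m]≡n i≤m) (+-monoʳ-< i k<m-i) , (<⇒≢ (s≤s (m≤m+n i k))) ∘ sym)

unique-otherParts : ∀ m i → Unique (otherParts m i)
unique-otherParts m i = AllPairs.++⁺ (Unique.upTo⁺ i)
  (Unique.applyUpTo⁺₁ _ (m ∸ i) λ k<l _ → <⇒≢ k<l ∘ +-cancelˡ-≡ i _ _ ∘ suc-injective)
  (All.map (λ j<i → All.applyUpTo⁺₂ _ (m ∸ i) λ k → <⇒≢ (<-≤-trans j<i (≤-trans (m≤m+n i k) (n≤1+n (i + k)))))
           (All.all-upTo i))

fullLayers : ℕ → ℕ → ℕ → List Vertex
fullLayers m i zero    = []
fullLayers m i (suc y) = fullLayers m i y ++ map (y ,_) (otherParts m i)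

earlierNeighbours : ℕ → ℕ → ℕ → List Vertex
earlierNeighbours m t i = fullLayers m i t ++ map (t ,_) (upTo i)

length-fullLayers : ∀ {m i} y → i ≤ m → length (fullLayers m i y) ≡ y * m
length-fullLayers zero    i≤m = refl
length-fullLayers {m} {i} (suc y) i≤m = begin
  length (fullLayers m i y ++ map (y ,_) (otherParts m i))
    ≡⟨ length-++ (fullLayers m i y) ⟩
  length (fullLayers m i y) + length (map (y ,_) (otherParts m i))
    ≡⟨ cong₂ _+_ (length-fullLayers y i≤m) (trans (length-map _ (otherParts m i)) (length-otherParts i≤m)) ⟩
  y * m + m
    ≡⟨ +-comm (y * m) m ⟩
  suc y * m ∎
  where open ≡-Reasoning

length-earlierNeighbours : ∀ {m i} t → i ≤ m → length (earlierNeighbours m t i) ≡ t * m + i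
length-earlierNeighbours {m} {i} t i≤m =
  trans (length-++ (fullLayers m i t))
        (cong₂ _+_ (length-fullLayers t i≤m) (trans (length-map _ (upTo i)) (length-upTo i)))

all-fullLayers : ∀ {m i} y → i ≤ m → All (λ x → proj₁ x < y × proj₂ x ≤ m × proj₂ x ≢ i) (fullLayers m i y)
all-fullLayers zero    i≤m = []
all-fullLayers (suc y) i≤m = All.++⁺
  (All.map (λ (below , rest) → m<n⇒m<1+n below , rest) (all-fullLayers y i≤m))
  (All.map⁺ (All.map (n<1+n y ,_) (all-otherParts i≤m)))

all-earlierNeighbours : ∀ {m i} t → i ≤ m →
                        All (λ x → InLayers (suc m) t i x × proj₂ x ≢ i) (earlierNeighbours m t i)
all-earlierNeighbours t i≤m = All.++⁺
  (All.map (λ (below , j≤m , j≢i) → inj₁ (below , s≤s j≤m) , j≢i) (all-fullLayers t i≤m))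
  (All.map⁺ (All.map (λ j<i → inj₂ (refl , j<i) , <⇒≢ j<i) (All.all-upTo _)))

lower≢layer : ∀ {x : Vertex} {y} → proj₁ x < y → ∀ {js} → All (x ≢_) (map (y ,_) js)
lower≢layer below = All.map⁺ (All.universal (λ _ x≡yj → <⇒≢ below (cong proj₁ x≡yj)) _)

unique-fullLayers : ∀ {m i} y → i ≤ m → Unique (fullLayers m i y)
unique-fullLayers zero    i≤m = []
unique-fullLayers {m} {i} (suc y) i≤m = AllPairs.++⁺
  (unique-fullLayers y i≤m)
  (Unique.map⁺ (cong proj₂) (unique-otherParts m i))
  (All.map (λ (below , _) → lower≢layer below) (all-fullLayers y i≤m))

unique-earlierNeighbours : ∀ {m} t i → i ≤ m → Unique (earlierNeighbours m t i)
unique-earlierNeighbours t i i≤m = AllPairs.++⁺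
  (unique-fullLayers t i≤m)
  (Unique.map⁺ (cong proj₂) (Unique.upTo⁺ i))
  (All.map (λ (below , _) → lower≢layer below) (all-fullLayers t i≤m))

-- Each edge is listed when its later endpoint is added; splitting on i first lets
-- edges m t (suc i) unfold for an unknown t.
edges : ℕ → ℕ → ℕ → List Edge
edges m t       (suc i) = edges m t i ++ map (_, (t , i)) (earlierNeighbours m t i)
edges m zero    zero    = []
edges m (suc t) zero    = edges m t (suc m)

all-edges : ∀ m t i → i ≤ suc m → All (uncurry (Multipartite (suc m) t i)) (edges m t i)
all-edges m zero    zero    _   = []
all-edges m (suc t) zero    _   =
  All.map (λ (a∈ , b∈ , parts≢) → InLayers-next a∈ , InLayers-next b∈ , parts≢)
          (all-edges m t (suc m) ≤-refl)
all-edges m t       (suc i) i<M = All.++⁺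
  (All.map (λ (a∈ , b∈ , parts≢) → InLayers-suc a∈ , InLayers-suc b∈ , parts≢) (all-edges m t i (<⇒≤ i<M)))
  (All.map⁺ (All.map (λ (x∈ , part≢i) → InLayers-suc x∈ , inj₂ (refl , n<1+n i) , part≢i)
                     (all-earlierNeighbours t (≤-pred i<M))))

distinct-edges : ∀ m t i → i ≤ suc m → AllPairs DistinctEdgesᵉ (edges m t i)
distinct-edges m zero    zero    _   = []
distinct-edges m (suc t) zero    _   = distinct-edges m t (suc m) ≤-refl
distinct-edges m t       (suc i) i<M = AllPairs.++⁺
  (distinct-edges m t i (<⇒≤ i<M))
  (AllPairs.map⁺ (AllPairs.map star (unique-earlierNeighbours t i (≤-pred i<M))))
  (All.map (λ (a∈ , b∈ , _) → All.map⁺ (All.universal (λ _ → old≠new a∈ b∈) _)) (all-edges m t i (<⇒≤ i<M)))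
  where
  star : ∀ {x y v} → x ≢ y → DistinctEdges x v y v
  star x≢y (inj₁ (x≡y , _))    = x≢y x≡y
  star x≢y (inj₂ (x≡v , v≡y)) = x≢y (trans x≡v v≡y)

  old≠new : ∀ {a b u} → InLayers (suc m) t i a → InLayers (suc m) t i b → DistinctEdges a b u (t , i)
  old≠new a∈ b∈ (inj₁ (_ , refl)) = fresh b∈
  old≠new a∈ b∈ (inj₂ (refl , _)) = fresh a∈

choose₂ : ℕ → ℕ
choose₂ zero    = 0
choose₂ (suc n) = choose₂ n + n

choose₂-double : ∀ m → choose₂ (suc m) + choose₂ (suc m) ≡ suc m * m
choose₂-double zero    = refl
choose₂-double (suc m) = begin
  (c + suc m) + (c + suc m) ≡⟨ regroup c (suc m) ⟩
  (c + c) + (suc m + suc m) ≡⟨ cong (_+ (suc m + suc m)) (choose₂-double m) ⟩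
  suc m * m + (suc m + suc m) ≡⟨ expand m ⟩
  suc (suc m) * suc m ∎
  where
  open ≡-Reasoning
  c : ℕ
  c = choose₂ (suc m)
  regroup : ∀ c n → c + n + (c + n) ≡ c + c + (n + n)
  regroup = solve-∀
  expand : ∀ m → suc m * m + (suc m + suc m) ≡ suc (suc m) * suc m
  expand = solve-∀

edgeCount : ℕ → ℕ → ℕ → ℕ
edgeCount m t i = t * t * choose₂ (suc m) + i * t * m + choose₂ i

edgeCount-suc : ∀ m t i → edgeCount m t (suc i) ≡ edgeCount m t i + (t * m + i)
edgeCount-suc m t i = expand t i m (choose₂ (suc m)) (choose₂ i)
  where
  expand : ∀ t i m c c′ → t * t * c + suc i * t * m + (c′ + i) ≡ t * t * c + i * t * m + c′ + (t * m + i)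
  expand = solve-∀

edgeCount-next-layer : ∀ m t → edgeCount m (suc t) 0 ≡ edgeCount m t (suc m)
edgeCount-next-layer m t = begin
  suc t * suc t * c + 0 * suc t * m + 0 ≡⟨ expand t c ⟩
  t * t * c + t * (c + c) + c           ≡⟨ cong (λ n → t * t * c + t * n + c) (choose₂-double m) ⟩
  t * t * c + t * (suc m * m) + c       ≡⟨ regroup t m c ⟩
  t * t * c + suc m * t * m + c         ∎
  where
  open ≡-Reasoning
  c : ℕ
  c = choose₂ (suc m)
  expand : ∀ t c → suc t * suc t * c + 0 * suc t * m + 0 ≡ t * t * c + t * (c + c) + c
  expand = solve-∀
  regroup : ∀ t m c → t * t * c + t * (suc m * m) + c ≡ t * t * c + suc m * t * m + c
  regroup = solve-∀

edgeCount-switch : ∀ n → edgeCount n 4 0 ≡ edgeCount (2 * n) 2 1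
edgeCount-switch n = begin
  4 * 4 * c + 0 * 4 * n + 0                ≡⟨ expand c ⟩
  8 * (c + c)                               ≡⟨ cong (8 *_) (choose₂-double n) ⟩
  8 * (suc n * n)                           ≡⟨ regroup n ⟩
  2 * (suc (2 * n) * (2 * n)) + 2 * (2 * n) ≡⟨ cong (λ k → 2 * k + 2 * (2 * n)) (sym (choose₂-double (2 * n))) ⟩
  2 * (c′ + c′) + 2 * (2 * n)               ≡⟨ contract c′ (2 * n) ⟩
  2 * 2 * c′ + 1 * 2 * (2 * n) + 0         ∎
  where
  open ≡-Reasoning
  c c′ : ℕ
  c  = choose₂ (suc n)
  c′ = choose₂ (suc (2 * n))
  expand : ∀ c → 4 * 4 * c + 0 * 4 * n + 0 ≡ 8 * (c + c)
  expand = solve-∀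
  regroup : ∀ n → 8 * (suc n * n) ≡ 2 * (suc (2 * n) * (2 * n)) + 2 * (2 * n)
  regroup = solve-∀
  contract : ∀ c k → 2 * (c + c) + 2 * k ≡ 2 * 2 * c + 1 * 2 * k + 0
  contract = solve-∀

length-edges : ∀ m t i → i ≤ suc m → length (edges m t i) ≡ edgeCount m t i
length-edges m zero    zero    _   = refl
length-edges m (suc t) zero    _   = trans (length-edges m t (suc m) ≤-refl) (sym (edgeCount-next-layer m t))
length-edges m t       (suc i) i<M = begin
  length (edges m t i ++ map _ (earlierNeighbours m t i))
    ≡⟨ length-++ (edges m t i) ⟩
  length (edges m t i) + length (map _ (earlierNeighbours m t i))
    ≡⟨ cong₂ _+_ (length-edges m t i (<⇒≤ i<M))
                 (trans (length-map _ (earlierNeighbours m t i)) (length-earlierNeighbours t (≤-pred i<M))) ⟩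
  edgeCount m t i + (t * m + i)
    ≡⟨ edgeCount-suc m t i ⟨
  edgeCount m t (suc i) ∎
  where open ≡-Reasoning

-- The sequence a

b-suc : ∀ e → b (3 + e) ≡ b (2 + e) + a (suc e)
b-suc e = begin
  4 + sum (map f (upTo (suc e)))          ≡⟨ cong (λ xs → 4 + sum (map f xs)) (sym (upTo-∷ʳ e)) ⟩
  4 + sum (map f (upTo e ∷ʳ e))           ≡⟨ cong (λ xs → 4 + sum xs) (map-++ f (upTo e) [ e ]) ⟩
  4 + sum (map f (upTo e) ++ [ f e ])     ≡⟨ cong (4 +_) (sum-++ (map f (upTo e)) [ f e ]) ⟩
  4 + (sum (map f (upTo e)) + (f e + 0))  ≡⟨ cong (λ n → 4 + (sum (map f (upTo e)) + n)) (+-identityʳ (f e)) ⟩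
  4 + (sum (map f (upTo e)) + f e)        ≡⟨ +-assoc 4 _ (f e) ⟨
  b (2 + e) + a (suc e)                   ∎
  where
  open ≡-Reasoning
  f : ℕ → ℕ
  f i = a (suc i)

aPrefix-suc : ∀ K → aPrefix (suc K) ≡ aPrefix K ++ replicate (mult (2 + K)) (2 + K)
aPrefix-suc K = begin
  concatMap entries (map (2 +_) (upTo (suc K)))
    ≡⟨ cong (concatMap entries ∘ map (2 +_)) (sym (upTo-∷ʳ K)) ⟩
  concatMap entries (map (2 +_) (upTo K ∷ʳ K))
    ≡⟨ cong (concatMap entries) (map-++ (2 +_) (upTo K) [ K ]) ⟩
  concatMap entries (map (2 +_) (upTo K) ++ [ 2 + K ])
    ≡⟨ concatMap-++ entries (map (2 +_) (upTo K)) [ 2 + K ] ⟩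
  aPrefix K ++ (replicate (mult (2 + K)) (2 + K) ++ [])
    ≡⟨ cong (aPrefix K ++_) (++-identityʳ _) ⟩
  aPrefix K ++ replicate (mult (2 + K)) (2 + K) ∎
  where
  open ≡-Reasoning
  entries : ℕ → List ℕ
  entries m = replicate (mult m) m

length-aPrefix-suc : ∀ K → length (aPrefix (suc K)) ≡ length (aPrefix K) + mult (2 + K)
length-aPrefix-suc K = trans (cong length (aPrefix-suc K))
  (trans (length-++ (aPrefix K)) (cong (length (aPrefix K) +_) (length-replicate (mult (2 + K)))))

aPrefix-extends : ∀ d K → ∃ λ rest → aPrefix (d + K) ≡ aPrefix K ++ rest
aPrefix-extends zero    K = [] , sym (++-identityʳ (aPrefix K))
aPrefix-extends (suc d) K with aPrefix-extends d K
... | rest , eq = rest ++ replicate (mult (2 + (d + K))) (2 + (d + K)) , trans (aPrefix-suc (d + K))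
                                    (trans (cong (_++ _) eq) (++-assoc (aPrefix K) rest _))

aPrefix-bounded : ∀ K → All (_≤ suc K) (aPrefix K)
aPrefix-bounded zero    = []
aPrefix-bounded (suc K) rewrite aPrefix-suc K =
  All.++⁺ (All.map m≤n⇒m≤1+n (aPrefix-bounded K)) (All.replicate⁺ (mult (2 + K)) ≤-refl)

nth-++ : ∀ xs ys {i} → i < length xs → nth (xs ++ ys) i ≡ nth xs i
nth-++ (x ∷ xs) ys {zero}  _         = refl
nth-++ (x ∷ xs) ys {suc i} (s≤s i<) = nth-++ xs ys i<

nth-bounded : ∀ {B xs} → All (_≤ B) xs → ∀ i → nth xs i ≤ B
nth-bounded []         i       = z≤n
nth-bounded (x≤ ∷ xs≤) zero    = x≤
nth-bounded (x≤ ∷ xs≤) (suc i) = nth-bounded xs≤ i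

mult≥1 : ∀ m → 1 ≤ mult m
mult≥1 m with isThreePow2 m
... | true  = s≤s z≤n
... | false = s≤s z≤n

n<2^n : ∀ n → n < 2 ^ n
n<2^n zero    = s≤s z≤n
n<2^n (suc n) = +-mono-≤ (m^n>0 2 n) (subst (n <_) (sym (+-identityʳ (2 ^ n))) (n<2^n n))

isThreePow2-3·2^ : ∀ j → T (isThreePow2 (3 * 2 ^ j))
isThreePow2-3·2^ j =
  any⁺ _ (lose (∈-upTo⁺ (≤-trans (n<2^n j) (m≤m+n (2 ^ j) _))) (≡⇒≡ᵇ (3 * 2 ^ j) _ refl))

mult-3·2^ : ∀ j → mult (3 * 2 ^ j) ≡ 2
mult-3·2^ j with isThreePow2 (3 * 2 ^ j) | isThreePow2-3·2^ j
... | true | _ = refl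

K≤length-aPrefix : ∀ K → K ≤ length (aPrefix K)
K≤length-aPrefix zero    = z≤n
K≤length-aPrefix (suc K) = begin
  suc K                                 ≡⟨ +-comm 1 K ⟩
  K + 1                                 ≤⟨ +-mono-≤ (K≤length-aPrefix K) (mult≥1 (2 + K)) ⟩
  length (aPrefix K) + mult (2 + K)     ≡⟨ length-aPrefix-suc K ⟨
  length (aPrefix (suc K))              ∎
  where open ≤-Reasoning

-- Each of the values 3·2⁰, …, 3·2ʲ ≤ K + 1 contributes one extra entry.
length-aPrefix-≥ : ∀ K j → 3 * 2 ^ j ≤ suc K → K + suc j ≤ length (aPrefix K)
length-aPrefix-≥ zero    j 3·2^j≤1 = ⊥-elim (<⇒≱ (s≤s (s≤s z≤n)) (≤-trans (*-monoʳ-≤ 3 (m^n>0 2 j)) 3·2^j≤1))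
length-aPrefix-≥ (suc K) j 3·2^j≤2+K with 3 * 2 ^ j ≤? suc K
... | yes 3·2^j≤1+K = begin
  suc K + suc j                         ≡⟨ +-comm 1 (K + suc j) ⟩
  K + suc j + 1                         ≤⟨ +-mono-≤ (length-aPrefix-≥ K j 3·2^j≤1+K) (mult≥1 (2 + K)) ⟩
  length (aPrefix K) + mult (2 + K)     ≡⟨ length-aPrefix-suc K ⟨
  length (aPrefix (suc K))              ∎
  where open ≤-Reasoning
... | no  3·2^j≰1+K = begin
  suc K + suc j                         ≡⟨ shuffle K j ⟩
  K + j + 2                             ≤⟨ +-monoˡ-≤ 2 (previous j 3·2^j≡2+K) ⟩
  length (aPrefix K) + 2                ≡⟨ cong (length (aPrefix K) +_) mult≡2 ⟨
  length (aPrefix K) + mult (2 + K)     ≡⟨ length-aPrefix-suc K ⟨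
  length (aPrefix (suc K))              ∎
  where
  open ≤-Reasoning
  3·2^j≡2+K : 3 * 2 ^ j ≡ 2 + K
  3·2^j≡2+K = ≤-antisym 3·2^j≤2+K (≰⇒> 3·2^j≰1+K)
  mult≡2 : mult (2 + K) ≡ 2
  mult≡2 = trans (cong mult (sym 3·2^j≡2+K)) (mult-3·2^ j)
  shuffle : ∀ K j → suc K + suc j ≡ K + j + 2
  shuffle = solve-∀
  previous : ∀ j → 3 * 2 ^ j ≡ 2 + K → K + j ≤ length (aPrefix K)
  previous zero    _  = subst (_≤ length (aPrefix K)) (sym (+-identityʳ K)) (K≤length-aPrefix K)
  previous (suc j) eq = length-aPrefix-≥ K j
    (≤-pred (subst (3 * 2 ^ j <_) eq (*-monoʳ-< 3 (^-monoʳ-< 2 (s≤s (s≤s z≤n)) (n<1+n j)))))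

nth-aPrefix-stable : ∀ K d {i} → i < length (aPrefix K) → nth (aPrefix (d + K)) i ≡ nth (aPrefix K) i
nth-aPrefix-stable K d {i} i< with aPrefix-extends d K
... | rest , eq = trans (cong (λ xs → nth xs i) eq) (nth-++ (aPrefix K) rest i<)

a-≤ : ∀ K n → n ≤ length (aPrefix K) → a n ≤ suc K
a-≤ K zero    _       = z≤n
a-≤ K (suc n) 1+n≤len = subst (_≤ suc K) (sym a≡nth) (nth-bounded (aPrefix-bounded K) n)
  where
  a≡nth : a (suc n) ≡ nth (aPrefix K) n
  a≡nth = begin
    nth (aPrefix (suc n)) n       ≡⟨ nth-aPrefix-stable (suc n) K (K≤length-aPrefix (suc n)) ⟨
    nth (aPrefix (K + suc n)) n   ≡⟨ cong (λ k → nth (aPrefix k) n) (+-comm K (suc n)) ⟩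
    nth (aPrefix (suc n + K)) n   ≡⟨ nth-aPrefix-stable K (suc n) 1+n≤len ⟩
    nth (aPrefix K) n             ∎
    where open ≡-Reasoning

a-≤-threshold : ∀ j v n → 3 * 2 ^ j ≤ v → n ≤ v + j → a n ≤ v
a-≤-threshold j zero    n 3·2^j≤0 _   = ⊥-elim (<⇒≱ (<-≤-trans (s≤s z≤n) (*-monoʳ-≤ 3 (m^n>0 2 j))) 3·2^j≤0)
a-≤-threshold j (suc K) n 3·2^j≤v n≤ =
  a-≤ K n (≤-trans n≤ (subst (_≤ length (aPrefix K)) (+-suc K j) (length-aPrefix-≥ K j 3·2^j≤v)))

-- The construction

seedDim-spec : ∀ k → seedDim k + 2 ≡ suc (2 ^ k) + k
seedDim-spec zero    = refl
seedDim-spec (suc k) = begin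
  2 ^ k + suc (seedDim k) + 2     ≡⟨ regroup (2 ^ k) (seedDim k) ⟩
  suc (2 ^ k) + (seedDim k + 2)   ≡⟨ cong (suc (2 ^ k) +_) (seedDim-spec k) ⟩
  suc (2 ^ k) + (suc (2 ^ k) + k) ≡⟨ double (2 ^ k) k ⟩
  suc (2 * 2 ^ k) + suc k         ∎
  where
  open ≡-Reasoning
  regroup : ∀ x s → x + suc s + 2 ≡ suc x + (s + 2)
  regroup = solve-∀
  double : ∀ x k → suc x + (suc x + k) ≡ suc (2 * x) + suc k
  double = solve-∀

-- n = d − 1 for a stage in dimension d; the next vertex brings (s + 1) 2ᵏ + i new edges.
a-bound : ∀ k s i n → s ≡ 1 ⊎ s ≡ 2 → n + 3 ≡ suc s * suc (2 ^ k) + i + k → a n ≤ suc s * 2 ^ k + i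
a-bound k       _ i n (inj₂ refl) eq =
  a-≤-threshold k (3 * 2 ^ k + i) n (m≤m+n _ i) (≤-reflexive (+-cancelʳ-≡ 3 _ _ (trans eq (regroup (2 ^ k) i k))))
  where
  regroup : ∀ x i k → 3 * suc x + i + k ≡ 3 * x + i + k + 3
  regroup = solve-∀
a-bound zero    _ i n (inj₁ refl) eq =
  a-≤ (suc i) n (≤-trans (≤-reflexive (+-cancelʳ-≡ 3 _ _ (trans eq (regroup i)))) (K≤length-aPrefix (suc i)))
  where
  regroup : ∀ i → 2 * 2 + i + 0 ≡ suc i + 3
  regroup = solve-∀
a-bound (suc k) _ i n (inj₁ refl) eq =
  a-≤-threshold k (2 * 2 ^ suc k + i) n (≤-trans (3x≤4x (2 ^ k)) (m≤m+n _ i))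
    (≤-reflexive (+-cancelʳ-≡ 3 _ _ (trans eq (regroup (2 ^ k) i k))))
  where
  regroup : ∀ x i k → 2 * suc (2 * x) + i + suc k ≡ 2 * (2 * x) + i + k + 3
  regroup = solve-∀
  split : ∀ x → 3 * x + x ≡ 2 * (2 * x)
  split = solve-∀
  3x≤4x : ∀ x → 3 * x ≤ 2 * (2 * x)
  3x≤4x x = subst (3 * x ≤_) (split x) (m≤m+n (3 * x) x)

-- Only two or three full layers are used: a fourth would have as many edges as the graph
-- on 2ᵏ⁺¹ + 1 parts reached in the same dimension, which then grows faster.
record Stage (d : ℕ) : Set where
  field
    k s i  : ℕ
    s≡1∨2  : s ≡ 1 ⊎ s ≡ 2
    i≤2^k  : i ≤ 2 ^ k
    dim    : d ≡ s * suc (2 ^ k) + i + seedDim k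
    enough : b d ≤ edgeCount (2 ^ k) (suc s) i

stage₂ : Stage 2
stage₂ = record { k = 0 ; s = 1 ; i = 0 ; s≡1∨2 = inj₁ refl ; i≤2^k = z≤n ; dim = refl ; enough = ≤-refl }

enough-next : ∀ {e} (st : Stage (2 + e)) → let open Stage st in
              b (3 + e) ≤ edgeCount (2 ^ k) (suc s) (suc i)
enough-next {e} st = begin
  b (3 + e)                                       ≡⟨ b-suc e ⟩
  b (2 + e) + a (suc e)                           ≤⟨ +-mono-≤ enough (a-bound k s i (suc e) s≡1∨2 index) ⟩
  edgeCount (2 ^ k) (suc s) i + (suc s * 2 ^ k + i) ≡⟨ edgeCount-suc (2 ^ k) (suc s) i ⟨
  edgeCount (2 ^ k) (suc s) (suc i)               ∎
  where
  open Stage st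
  open ≤-Reasoning
  regroup₁ : ∀ e → suc e + 3 ≡ 2 + e + 2
  regroup₁ = solve-∀
  regroup₂ : ∀ s x i k → s * suc x + i + (suc x + k) ≡ suc s * suc x + i + k
  regroup₂ = solve-∀
  index : suc e + 3 ≡ suc s * suc (2 ^ k) + i + k
  index = begin-equality
    suc e + 3                                     ≡⟨ regroup₁ e ⟩
    2 + e + 2                                     ≡⟨ cong (_+ 2) dim ⟩
    s * suc (2 ^ k) + i + seedDim k + 2           ≡⟨ +-assoc _ (seedDim k) 2 ⟩
    s * suc (2 ^ k) + i + (seedDim k + 2)         ≡⟨ cong (s * suc (2 ^ k) + i +_) (seedDim-spec k) ⟩
    s * suc (2 ^ k) + i + (suc (2 ^ k) + k)       ≡⟨ regroup₂ s (2 ^ k) i k ⟩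
    suc s * suc (2 ^ k) + i + k                   ∎

next-stage : ∀ e → Stage (2 + e) → Stage (3 + e)
next-stage e st@record { k = k ; s = s ; i = i ; s≡1∨2 = s≡1∨2 ; i≤2^k = i≤2^k ; dim = dim }
  with m≤n⇒m<n∨m≡n i≤2^k | s≡1∨2
... | inj₁ i<2^k | _ = record
  { k = k ; s = s ; i = suc i ; s≡1∨2 = s≡1∨2 ; i≤2^k = i<2^k
  ; dim    = trans (cong suc dim) (cong (_+ seedDim k) (sym (+-suc (s * suc (2 ^ k)) i)))
  ; enough = enough-next st }
... | inj₂ refl | inj₁ refl = record
  { k = k ; s = 2 ; i = 0 ; s≡1∨2 = inj₂ refl ; i≤2^k = z≤n
  ; dim    = trans (cong suc dim) (regroup (2 ^ k) (seedDim k))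
  ; enough = subst (b (3 + e) ≤_) (sym (edgeCount-next-layer (2 ^ k) 2)) (enough-next st) }
  where
  regroup : ∀ x d → suc (1 * suc x + x + d) ≡ 2 * suc x + 0 + d
  regroup = solve-∀
... | inj₂ refl | inj₂ refl = record
  { k = suc k ; s = 1 ; i = 1 ; s≡1∨2 = inj₁ refl ; i≤2^k = m^n>0 2 (suc k)
  ; dim    = trans (cong suc dim) (regroup (2 ^ k) (seedDim k))
  ; enough = subst (b (3 + e) ≤_) (trans (sym (edgeCount-next-layer (2 ^ k) 3)) (edgeCount-switch (2 ^ k)))
                   (enough-next st) }
  where
  regroup : ∀ x d → suc (2 * suc x + x + d) ≡ 1 * suc (2 * x) + 1 + (x + suc d)
  regroup = solve-∀

stage : ∀ d → 2 ≤ d → Stage d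
stage (suc zero)          (s≤s ())
stage (suc (suc zero))    _ = stage₂
stage (suc (suc (suc e))) _ = next-stage e (stage (suc (suc e)) (s≤s (s≤s z≤n)))

stage-code : ∀ {d} (st : Stage d) → let open Stage st in
             EdgeCode (Multipartite (suc (2 ^ k)) (suc s) i) d
stage-code st = subst (EdgeCode _) (sym dim) (multipartite (seed k) s i (m≤n⇒m≤1+n i≤2^k))
  where open Stage st

theorem5 : ∀ (d : ℕ) → 2 ≤ d → bp₂≤ (b d) d
theorem5 d 2≤d = wordCode⇒bp₂≤ (edgeList⇒wordCode (stage-code st) (edges (2 ^ k) (suc s) i)
                                   (all-edges _ _ _ i≤M) (distinct-edges _ _ _ i≤M) enough-edges)
  where
  st : Stage d
  st = stage d 2≤d
  open Stage st
  i≤M : i ≤ suc (2 ^ k)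
  i≤M = m≤n⇒m≤1+n i≤2^k
  enough-edges : b d ≤ length (edges (2 ^ k) (suc s) i)
  enough-edges = subst (b d ≤_) (sym (length-edges (2 ^ k) (suc s) i i≤M)) enough
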